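{- Let $\bar p=(p_1,p_2,\dots)$ be an infinite sequence with $p_i\in\{0,1\}$ for all $i\ge1$ and such that $U^*(\bar p)=\{l\ge1:p_l=1\}$ is finite. Then $M^n_{\bar p}$ satisfies the 0-1 law for $L$.
   Context: $M^n_{\bar p}$ is the random graph on vertex set $[n]=\{1,\dots,n\}$ where for $i\ne j$, $\{i,j\}$ is an edge with probability $p_{|i-j|}$, independently. $L$ is first-order logic in the vocabulary $\{\sim\}$ of graphs. The 0-1 law holds if for every $L$-sentence $\psi$, $\lim_n\Pr[M^n_{\bar p}\models\psi]$ exists and is $0$ or $1$. -}

module Defs where

open import Data.Nat as ℕ using (ℕ; zero; suc; _∸_)
open import Data.Fin as Fin using (Fin; toℕ)
open import Data.Bool using (Bool; true; false; _∧_; _∨_; not; if_then_else_)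
open import Data.List using (List; []; _∷_; allFin; concatMap)
open import Data.Bool.ListAction using (any; all)
open import Data.Rational using (ℚ; 0ℚ; 1ℚ; _+_; _*_; _-_; ∣_∣; _<_)
open import Data.Product using (∃; _×_; _,_)
open import Relation.Nullary.Decidable using (⌊_⌋)
open import Relation.Binary.PropositionalEquality using (_≡_)
open import Data.Sum using (_⊎_)

-- First-order logic in the vocabulary {∼} of graphs.
-- Formula k = formulas with free variables among k de Bruijn indices.

data Formula : ℕ → Set where
  _≐_  : ∀ {k} → Fin k → Fin k → Formula k
  _∼_  : ∀ {k} → Fin k → Fin k → Formula k
  ⊤f ⊥f : ∀ {k} → Formula k
  ¬f_  : ∀ {k} → Formula k → Formula k
  _∧f_ _∨f_ _⇒f_ : ∀ {k} → Formula k → Formula k → Formula k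
  ∃f ∀f : ∀ {k} → Formula (suc k) → Formula k

Sentence : Set
Sentence = Formula 0

-- A graph on vertex set Fin n (≅ [n]) given by a symmetric adjacency test.
Graph : ℕ → Set
Graph n = Fin n → Fin n → Bool

extend : ∀ {n k} → Fin n → (Fin k → Fin n) → Fin (suc k) → Fin n
extend x ρ Fin.zero = x
extend x ρ (Fin.suc i) = ρ i

sat : ∀ {n k} → Graph n → Formula k → (Fin k → Fin n) → Bool
sat G (i ≐ j) ρ = ⌊ ρ i Fin.≟ ρ j ⌋
sat G (i ∼ j) ρ = G (ρ i) (ρ j)
sat G ⊤f ρ = true
sat G ⊥f ρ = false
sat G (¬f φ) ρ = not (sat G φ ρ)
sat G (φ ∧f ψ) ρ = sat G φ ρ ∧ sat G ψ ρ
sat G (φ ∨f ψ) ρ = sat G φ ρ ∨ sat G ψ ρ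
sat G (φ ⇒f ψ) ρ = not (sat G φ ρ) ∨ sat G ψ ρ
sat {n} G (∃f φ) ρ = any (λ x → sat G φ (extend x ρ)) (allFin n)
sat {n} G (∀f φ) ρ = all (λ x → sat G φ (extend x ρ)) (allFin n)

noVars : ∀ {n} → Fin 0 → Fin n
noVars ()

_⊨_ : ∀ {n} → Graph n → Sentence → Bool
G ⊨ ψ = sat G ψ noVars

-- The random graph M^n_p̄.
-- An edge assignment g : Fin n → Fin n → Bool is read on pairs (i , j)
-- with toℕ i < toℕ j; the resulting (symmetric, loopless) graph:

_<ᵇ_ : ℕ → ℕ → Bool
m <ᵇ n = ⌊ suc m ℕ.≤? n ⌋

toGraph : ∀ {n} → (Fin n → Fin n → Bool) → Graph n
toGraph g x y =
  if toℕ x <ᵇ toℕ y then g x y else (if toℕ y <ᵇ toℕ x then g y x else false)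

pairs : ∀ n → List (Fin n × Fin n)
pairs n = concatMap (λ i → concatMap (λ j →
  if toℕ i <ᵇ toℕ j then (i , j) ∷ [] else []) (allFin n)) (allFin n)

update : ∀ {n} → Fin n × Fin n → Bool → (Fin n → Fin n → Bool) → Fin n → Fin n → Bool
update (i , j) b g x y = if ⌊ x Fin.≟ i ⌋ ∧ ⌊ y Fin.≟ j ⌋ then b else g x y

-- Expectation of f over independent edges: the pair (i , j) is an edge
-- with probability w (i , j).
expect : ∀ {n} → (Fin n × Fin n → ℚ) → List (Fin n × Fin n)
       → ((Fin n → Fin n → Bool) → ℚ) → ℚ
expect w [] f = f (λ _ _ → false)
expect w (e ∷ es) f =
  w e * expect w es (λ g → f (update e true g))
  + (1ℚ - w e) * expect w es (λ g → f (update e false g))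

indicator : Bool → ℚ
indicator true = 1ℚ
indicator false = 0ℚ

-- Pr[ M^n_p̄ ⊨ ψ ], where {i,j} is an edge with probability p_{|i-j|}.
Pr : (ℕ → ℚ) → ℕ → Sentence → ℚ
Pr p n ψ = expect (λ { (i , j) → p (toℕ j ∸ toℕ i) }) (pairs n)
                  (λ g → indicator (toGraph g ⊨ ψ))

ConvergesTo : (ℕ → ℚ) → ℚ → Set
ConvergesTo a L = ∀ ε → 0ℚ < ε → ∃ λ N → ∀ n → N ℕ.≤ n → ∣ a n - L ∣ < ε

ZeroOneLaw : (ℕ → ℚ) → Set
ZeroOneLaw p = ∀ (ψ : Sentence) → ∃ λ L →
  (L ≡ 0ℚ ⊎ L ≡ 1ℚ) × ConvergesTo (λ n → Pr p n ψ) L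

module Submission where

-- With probabilities in {0,1} the random graph is not random at all:
-- M^n_p̄ is surely the "distance graph" on [n] in which x ∼ y iff
-- p_|x-y| = 1, so Pr[M^n_p̄ ⊨ ψ] is 0 or 1 for every n.  Since p_l = 1 only
-- for l ≤ B, adjacency depends on x - y only up to "beyond ±(B+1)".  An
-- Ehrenfeucht–Fraïssé argument then shows that the distance graphs on [n]
-- and [m] satisfy the same sentences of quantifier depth d once n and m are
-- at least a threshold T_d (T_0 = B+1, T_{d+1} = 2 T_d): a position of the
-- game is a tuple of chosen points together with the sentinels 0 and n, and
-- the invariant is that corresponding pairwise differences are equal or lie
-- on the same side beyond ±T_d.  Hence Pr[M^n_p̄ ⊨ ψ] is eventually constant.

module FiniteQuantifiers where

  open import Data.Nat using (ℕ)
  open import Data.Bool using (Bool; true; false; T)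
  open import Data.Fin using (Fin)
  open import Data.List using (allFin)
  open import Data.Bool.ListAction using (any; all)
  open import Data.List.Membership.Propositional using (lose)
  open import Data.List.Membership.Propositional.Properties using (∈-allFin)
  open import Data.List.Relation.Unary.Any using (satisfied)
  open import Data.List.Relation.Unary.Any.Properties using (any⁺; any⁻)
  import Data.List.Relation.Unary.All as All
  open import Data.List.Relation.Unary.All.Properties using (all⁺; all⁻; tabulate⁺)
  open import Data.Product using (∃; _×_; _,_)
  open import Data.Empty using (⊥-elim)
  open import Relation.Binary.PropositionalEquality using (_≡_; refl; sym; subst)

  T-ext : ∀ {a b : Bool} → (T a → T b) → (T b → T a) → a ≡ b
  T-ext {false} {false} _ _ = refl
  T-ext {false} {true}  _ b⇒a = ⊥-elim (b⇒a _)
  T-ext {true}  {false} a⇒b _ = ⊥-elim (a⇒b _)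
  T-ext {true}  {true}  _ _ = refl

  BackAndForth : ∀ {n m} → (Fin n → Bool) → (Fin m → Bool) → Set
  BackAndForth f g = (∀ x → ∃ λ y → f x ≡ g y) × (∀ y → ∃ λ x → f x ≡ g y)

  module _ {n m : ℕ} {f : Fin n → Bool} {g : Fin m → Bool} where

    any-cong : BackAndForth f g → any f (allFin n) ≡ any g (allFin m)
    any-cong (forth , back) = T-ext
      (λ t → let x , fx = satisfied (any⁻ f (allFin n) t) ; y , fx≡gy = forth x
             in any⁺ {xs = allFin m} g (lose (∈-allFin y) (subst T fx≡gy fx)))
      (λ t → let y , gy = satisfied (any⁻ g (allFin m) t) ; x , fx≡gy = back y
             in any⁺ {xs = allFin n} f (lose (∈-allFin x) (subst T (sym fx≡gy) gy)))

    all-cong : BackAndForth f g → all f (allFin n) ≡ all g (allFin m)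
    all-cong (forth , back) = T-ext
      (λ t → all⁻ g (tabulate⁺ λ y → let x , fx≡gy = back y
             in subst T fx≡gy (All.lookup (all⁺ f (allFin n) t) (∈-allFin x))))
      (λ t → all⁻ f (tabulate⁺ λ x → let y , fx≡gy = forth x
             in subst T (sym fx≡gy) (All.lookup (all⁺ g (allFin m) t) (∈-allFin y))))

-- The invariant of the Ehrenfeucht–Fraïssé game, as integer combinatorics.
module Agreement where

  open import Data.Integer
    using (ℤ; +_; 0ℤ; _+_; _-_; -_; _≤_; _<_; _≤?_)
  open import Data.Integer.Properties
  open import Data.Integer.Tactic.RingSolver using (solve-∀)
  open import Data.Nat using (ℕ; suc)
  open import Data.Fin using (Fin; zero; suc)
  open import Function using (_∘_)
  open import Data.Fin.Properties using (any?)
  open import Data.Vec.Functional using (_∷_)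
  open import Data.Product using (∃; _×_; _,_)
  open import Relation.Nullary using (¬_; Dec; yes; no; contradiction)
  open import Relation.Nullary.Decidable using (_×-dec_)
  open import Relation.Unary using (Pred; Decidable)
  open import Relation.Binary.PropositionalEquality
    using (_≡_; refl; sym; subst; subst₂)
  open import Level using (0ℓ)

  data Agree (T : ℤ) : ℤ → ℤ → Set where
    same  : ∀ {u} → Agree T u u
    above : ∀ {u v} → T ≤ u → T ≤ v → Agree T u v
    below : ∀ {u v} → u ≤ - T → v ≤ - T → Agree T u v

  private
    variable
      T T' u v x y : ℤ

  neg-sub : ∀ a b → - (a - b) ≡ b - a
  neg-sub = solve-∀

  T≡-T+2T : ∀ T → T ≡ - T + (T + T)
  T≡-T+2T = solve-∀

  T-2T≡-T : ∀ T → T + - (T + T) ≡ - T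
  T-2T≡-T = solve-∀

  ≤-neg-flip : u ≤ - T → T ≤ - u
  ≤-neg-flip {u} {T} u≤-T = subst (_≤ - u) (neg-involutive T) (neg-mono-≤ u≤-T)

  <⇒0<sub : y < x → 0ℤ < x - y
  <⇒0<sub {y} {x} y<x = subst (_< x - y) (+-inverseʳ y) (+-monoˡ-< (- y) y<x)

  0<sub⇒< : 0ℤ < x - y → y < x
  0<sub⇒< {x} {y} 0<x-y with y <? x
  ... | yes y<x = y<x
  ... | no y≮x = contradiction 0<x-y (≤⇒≯ (i≤j⇒i-j≤0 (≮⇒≥ y≮x)))

  agree-sym : Agree T u v → Agree T v u
  agree-sym same = same
  agree-sym (above T≤u T≤v) = above T≤v T≤u
  agree-sym (below u≤-T v≤-T) = below v≤-T u≤-T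

  agree-neg : Agree T u v → Agree T (- u) (- v)
  agree-neg same = same
  agree-neg (above T≤u T≤v) = below (neg-mono-≤ T≤u) (neg-mono-≤ T≤v)
  agree-neg (below u≤-T v≤-T) = above (≤-neg-flip u≤-T) (≤-neg-flip v≤-T)

  agree-mono : T' ≤ T → Agree T u v → Agree T' u v
  agree-mono T'≤T same = same
  agree-mono T'≤T (above T≤u T≤v) = above (≤-trans T'≤T T≤u) (≤-trans T'≤T T≤v)
  agree-mono T'≤T (below u≤-T v≤-T) =
    below (≤-trans u≤-T (neg-mono-≤ T'≤T)) (≤-trans v≤-T (neg-mono-≤ T'≤T))

  not-below : 0ℤ < T → 0ℤ ≤ u → ¬ (u ≤ - T)
  not-below 0<T 0≤u u≤-T = <-irrefl refl (≤-<-trans (≤-trans 0≤u u≤-T) (neg-mono-< 0<T))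

  agree-nonneg : 0ℤ < T → 0ℤ ≤ u → Agree T u v → 0ℤ ≤ v
  agree-nonneg 0<T 0≤u same = 0≤u
  agree-nonneg 0<T 0≤u (above _ T≤v) = ≤-trans (<⇒≤ 0<T) T≤v
  agree-nonneg 0<T 0≤u (below u≤-T _) = contradiction u≤-T (not-below 0<T 0≤u)

  agree-pos : 0ℤ < T → 0ℤ < u → Agree T u v → 0ℤ < v
  agree-pos 0<T 0<u same = 0<u
  agree-pos 0<T 0<u (above _ T≤v) = <-≤-trans 0<T T≤v
  agree-pos 0<T 0<u (below u≤-T _) = contradiction u≤-T (not-below 0<T (<⇒≤ 0<u))

  agree-beyond : 0ℤ < T → T ≤ u → Agree T u v → T ≤ v
  agree-beyond 0<T T≤u same = T≤u
  agree-beyond 0<T T≤u (above _ T≤v) = T≤v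
  agree-beyond 0<T T≤u (below u≤-T _) =
    contradiction u≤-T (not-below 0<T (≤-trans (<⇒≤ 0<T) T≤u))

  Near : ℤ → ℤ → Set
  Near T e = - T < e × e < T

  near? : ∀ T e → Dec (Near T e)
  near? T e = (- T <? e) ×-dec (e <? T)

  far-nonneg : 0ℤ < T → ¬ Near T u → 0ℤ ≤ u → T ≤ u
  far-nonneg {T} {u} 0<T far 0≤u with T ≤? u
  ... | yes T≤u = T≤u
  ... | no T≰u = contradiction (<-≤-trans (neg-mono-< 0<T) 0≤u , ≰⇒> T≰u) far

  far-nonpos : 0ℤ < T → ¬ Near T u → u ≤ 0ℤ → u ≤ - T
  far-nonpos {T} {u} 0<T far u≤0 with u ≤? - T
  ... | yes u≤-T = u≤-T
  ... | no u≰-T = contradiction (≰⇒> u≰-T , ≤-<-trans u≤0 0<T) far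

  shift : ∀ {e} → Near T e → Agree (T + T) u v → Agree T (e + u) (e + v)
  shift _ same = same
  shift {T} {e = e} (-T<e , e<T) (above 2T≤u 2T≤v) = above (lift 2T≤u) (lift 2T≤v)
    where
    lift : ∀ {w} → T + T ≤ w → T ≤ e + w
    lift {w} 2T≤w = <⇒≤ (begin-strict
      T               ≡⟨ T≡-T+2T T ⟩
      - T + (T + T)   <⟨ +-mono-<-≤ -T<e 2T≤w ⟩
      e + w           ∎)
      where open ≤-Reasoning
  shift {T} {e = e} (-T<e , e<T) (below u≤-2T v≤-2T) = below (lower u≤-2T) (lower v≤-2T)
    where
    lower : ∀ {w} → w ≤ - (T + T) → e + w ≤ - T
    lower {w} w≤-2T = <⇒≤ (begin-strict
      e + w           <⟨ +-mono-<-≤ e<T w≤-2T ⟩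
      T + - (T + T)   ≡⟨ T-2T≡-T T ⟩
      - T             ∎)
      where open ≤-Reasoning

  record Similar {s} (T : ℤ) (P Q : Fin s → ℤ) : Set where
    constructor similar
    field agree : ∀ i j → Agree T (P j - P i) (Q j - Q i)
  open Similar public

  module _ {s : ℕ} {P Q : Fin s → ℤ} where

    similar-sym : Similar T P Q → Similar T Q P
    similar-sym sim = similar λ i j → agree-sym (agree sim i j)

    similar-≤ : 0ℤ < T → Similar T P Q → ∀ {i j} → P i ≤ P j → Q i ≤ Q j
    similar-≤ 0<T sim {i} {j} Pi≤Pj =
      0≤i-j⇒j≤i (agree-nonneg 0<T (i≤j⇒0≤j-i Pi≤Pj) (agree sim i j))

    similar-< : 0ℤ < T → Similar T P Q → ∀ {i j} → P i < P j → Q i < Q j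
    similar-< 0<T sim {i} {j} Pi<Pj = 0<sub⇒< (agree-pos 0<T (<⇒0<sub Pi<Pj) (agree sim i j))

    similar-≡ : 0ℤ < T → Similar T P Q → ∀ {i j} → P i ≡ P j → Q i ≡ Q j
    similar-≡ 0<T sim Pi≡Pj =
      ≤-antisym (similar-≤ 0<T sim (≤-reflexive Pi≡Pj)) (similar-≤ 0<T sim (≤-reflexive (sym Pi≡Pj)))

    similar-cons : T' ≤ T → Similar T P Q → (∀ i → Agree T' (x - P i) (y - Q i))
                 → Similar T' (x ∷ P) (y ∷ Q)
    agree (similar-cons {x = x} {y = y} _ _ _) zero zero =
      subst₂ (Agree _) (sym (+-inverseʳ x)) (sym (+-inverseʳ y)) same
    agree (similar-cons {x = x} {y = y} _ _ new) zero (suc j) =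
      subst₂ (Agree _) (neg-sub x (P j)) (neg-sub y (Q j)) (agree-neg (new j))
    agree (similar-cons _ _ new) (suc i) zero = new i
    agree (similar-cons T'≤T sim _) (suc i) (suc j) = agree-mono T'≤T (agree sim i j)

  greatest : ∀ {s} (P : Fin s → ℤ) {D : Pred (Fin s) 0ℓ} → Decidable D → ∃ D
           → ∃ λ i → D i × (∀ j → D j → P j ≤ P i)
  greatest {suc s} P D? (i , Di) with any? (D? ∘ suc)
  greatest {suc s} P D? (zero , D0) | no none =
    zero , D0 , λ { zero _ → ≤-refl ; (suc j) Dj → contradiction (j , Dj) none }
  greatest {suc s} P D? (suc i , Di) | no none = contradiction (i , Di) none
  greatest {suc s} P D? (i , Di) | yes some
    with greatest (P ∘ suc) (D? ∘ suc) some | D? zero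
  ... | i′ , Di′ , max | no ¬D0 =
    suc i′ , Di′ , λ { zero D0 → contradiction D0 ¬D0 ; (suc j) Dj → max j Dj }
  ... | i′ , Di′ , max | yes D0 with P zero ≤? P (suc i′)
  ...   | yes P0≤Pi′ = suc i′ , Di′ , λ { zero _ → P0≤Pi′ ; (suc j) Dj → max j Dj }
  ...   | no P0≰Pi′ = zero , D0 , λ
    { zero _ → ≤-refl ; (suc j) Dj → ≤-trans (max j Dj) (<⇒≤ (≰⇒> P0≰Pi′)) }

  -- If x is near some P i, copy its offset from P i to Q i:
  copy-offset : ∀ {s} {P Q : Fin s → ℤ} {i} → Similar (T + T) P Q → Near T (x - P i)
              → ∀ j → Agree T (x - P j) ((Q i + (x - P i)) - Q j)
  copy-offset {x = x} {P = P} {Q} {i} sim near j =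
    subst₂ (Agree _) (+-minus-telescope x (P i) (P j)) (offset (Q i) (x - P i) (Q j))
      (shift near (agree sim j i))
    where
    offset : ∀ a e b → e + (a - b) ≡ (a + e) - b
    offset = solve-∀

  -- otherwise x is far from every point: step T above the image of the
  -- greatest point of P below x.
  step-beyond : ∀ {s} {P Q : Fin s → ℤ} {i} → 0ℤ < T → Similar (T + T) P Q
              → (∀ j → ¬ Near T (x - P j)) → P i ≤ x → (∀ j → P j ≤ x → P j ≤ P i)
              → ∀ j → Agree T (x - P j) ((Q i + T) - Q j)
  step-beyond {T} {x} {P = P} {Q} {i} 0<T sim far Pi≤x max j with P j ≤? x
  ... | yes Pj≤x = above (far-nonneg 0<T (far j) (i≤j⇒0≤j-i Pj≤x)) (begin
    T                   ≡⟨ sym (+-identityʳ T) ⟩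
    T + 0ℤ              ≤⟨ +-monoʳ-≤ T Qj≤Qi ⟩
    T + (Q i - Q j)     ≡⟨ up (Q i) T (Q j) ⟩
    (Q i + T) - Q j     ∎)
    where
    open ≤-Reasoning
    Qj≤Qi : 0ℤ ≤ Q i - Q j
    Qj≤Qi = agree-nonneg (+-mono-< 0<T 0<T) (i≤j⇒0≤j-i (max j Pj≤x)) (agree sim j i)
    up : ∀ a T b → T + (a - b) ≡ (a + T) - b
    up = solve-∀
  ... | no Pj≰x = below x-Pj≤-T (begin
    (Q i + T) - Q j     ≡⟨ down (Q i) T (Q j) ⟩
    T - (Q j - Q i)     ≤⟨ +-monoʳ-≤ T (neg-mono-≤ 2T≤Qj-Qi) ⟩
    T - (T + T)         ≡⟨ T-2T≡-T T ⟩
    - T                 ∎)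
    where
    open ≤-Reasoning
    x-Pj≤-T : x - P j ≤ - T
    x-Pj≤-T = far-nonpos 0<T (far j) (i≤j⇒i-j≤0 (<⇒≤ (≰⇒> Pj≰x)))
    2T≤Pj-Pi : T + T ≤ P j - P i
    2T≤Pj-Pi = begin
      T + T                     ≤⟨ +-mono-≤ (subst (T ≤_) (neg-sub x (P j)) (≤-neg-flip x-Pj≤-T))
                                            (far-nonneg 0<T (far i) (i≤j⇒0≤j-i Pi≤x)) ⟩
      (P j - x) + (x - P i)     ≡⟨ +-minus-telescope (P j) x (P i) ⟩
      P j - P i                 ∎
    2T≤Qj-Qi : T + T ≤ Q j - Q i
    2T≤Qj-Qi = agree-beyond (+-mono-< 0<T 0<T) 2T≤Pj-Pi (agree sim i j)
    down : ∀ a T b → (a + T) - b ≡ T - (b - a)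
    down = solve-∀

  extension : ∀ {s} {P Q : Fin s → ℤ} → 0ℤ < T → Similar (T + T) P Q
            → (∃ λ i → P i ≤ x) → ∃ λ y → ∀ i → Agree T (x - P i) (y - Q i)
  extension {T} {x} {P = P} {Q} 0<T sim some-below with any? (λ i → near? T (x - P i))
  ... | yes (i , near) = Q i + (x - P i) , copy-offset {x = x} sim near
  ... | no none-near with greatest P (λ i → P i ≤? x) some-below
  ...   | i , Pi≤x , max =
    Q i + T , step-beyond 0<T sim (λ j near → none-near (j , near)) Pi≤x max

-- Ehrenfeucht–Fraïssé games on distance graphs.
module DistanceGraphs where

  open import Defs
  open FiniteQuantifiers
  open Agreement
  open import Data.Nat as ℕ using (ℕ; zero; suc; z≤n; s≤s; _⊔_)
  import Data.Nat.Properties as ℕ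
  open import Data.Integer
    using (ℤ; +_; 0ℤ; _+_; _-_; -_; _≤_; _<_; +≤+; +<+)
  open import Data.Integer.Properties
    using (+-identityʳ; +-identityˡ; +-inverseʳ; +-injective; neg-mono-≤; i≤i+j; ≤-trans)
  open import Data.Fin as Fin using (Fin; toℕ; _↑ˡ_; _↑ʳ_)
  open import Data.Fin.Properties using (toℕ<n; toℕ-injective; toℕ-fromℕ<)
  open import Data.Vec.Functional using (_∷_; [])
  open import Data.Bool using (Bool; false; not; _∧_; _∨_)
  open import Data.Product using (∃; _×_; _,_)
  open import Data.Sum using (_⊎_; inj₁; inj₂)
  open import Function using (_∘_; _⇔_; mk⇔)
  open import Relation.Nullary using (Dec)
  open import Relation.Nullary.Decidable using (⌊_⌋; isYes≗does; does-⇔)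
  open import Relation.Binary.PropositionalEquality
    using (_≡_; refl; sym; trans; cong; cong₂; subst; subst₂; module ≡-Reasoning)

  depth : ∀ {k} → Formula k → ℕ
  depth (_ ≐ _) = 0
  depth (_ ∼ _) = 0
  depth ⊤f = 0
  depth ⊥f = 0
  depth (¬f φ) = depth φ
  depth (φ ∧f ψ) = depth φ ⊔ depth ψ
  depth (φ ∨f ψ) = depth φ ⊔ depth ψ
  depth (φ ⇒f ψ) = depth φ ⊔ depth ψ
  depth (∃f φ) = suc (depth φ)
  depth (∀f φ) = suc (depth φ)

  IsDistanceGraph : (ℤ → Bool) → ∀ {n} → Graph n → Set
  IsDistanceGraph E G = ∀ x y → G x y ≡ E (+ toℕ y - + toℕ x)

  -- A position of the game on [n] after r moves: the chosen vertices,
  -- followed by the two sentinels 0 and n bounding the vertex set.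
  sentinels : ℕ → Fin 2 → ℤ
  sentinels n = 0ℤ ∷ (+ n ∷ [])

  position : ∀ {r} n → (Fin r → Fin n) → Fin (r ℕ.+ 2) → ℤ
  position {zero} n ρ = sentinels n
  position {suc r} n ρ = + toℕ (ρ Fin.zero) ∷ position n (ρ ∘ Fin.suc)

  position-vertex : ∀ {r n} (ρ : Fin r → Fin n) i → position n ρ (i ↑ˡ 2) ≡ + toℕ (ρ i)
  position-vertex ρ Fin.zero = refl
  position-vertex ρ (Fin.suc i) = position-vertex (ρ ∘ Fin.suc) i

  position-sentinel : ∀ r {n} (ρ : Fin r → Fin n) k → position n ρ (r ↑ʳ k) ≡ sentinels n k
  position-sentinel zero ρ k = refl
  position-sentinel (suc r) ρ k = position-sentinel r (ρ ∘ Fin.suc) k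

  initial-similar : ∀ {T n m} → T ≤ + n → T ≤ + m → Similar T (sentinels n) (sentinels m)
  agree (initial-similar _ _) Fin.zero Fin.zero = same
  agree (initial-similar {n = n} {m} _ _) (Fin.suc Fin.zero) (Fin.suc Fin.zero) =
    subst₂ (Agree _) (sym (+-inverseʳ (+ n))) (sym (+-inverseʳ (+ m))) same
  agree (initial-similar {T} {n} {m} T≤n T≤m) Fin.zero (Fin.suc Fin.zero) =
    above (subst (T ≤_) (sym (+-identityʳ (+ n))) T≤n) (subst (T ≤_) (sym (+-identityʳ (+ m))) T≤m)
  agree (initial-similar {T} {n} {m} T≤n T≤m) (Fin.suc Fin.zero) Fin.zero =
    below (subst (_≤ - T) (sym (+-identityˡ (- + n))) (neg-mono-≤ T≤n))
          (subst (_≤ - T) (sym (+-identityˡ (- + m))) (neg-mono-≤ T≤m))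

  vertex : ∀ {m y} → 0ℤ ≤ y → y < + m → ∃ λ (k : Fin m) → + toℕ k ≡ y
  vertex {y = + t} _ (+<+ t<m) = Fin.fromℕ< t<m , cong +_ (toℕ-fromℕ< t<m)

  vertex-gap : ∀ {T r n m} (ρ : Fin r → Fin n) (σ : Fin r → Fin m)
             → Similar T (position n ρ) (position m σ)
             → ∀ i j → Agree T (+ toℕ (ρ j) - + toℕ (ρ i)) (+ toℕ (σ j) - + toℕ (σ i))
  vertex-gap ρ σ sim i j =
    subst₂ (Agree _) (cong₂ _-_ (position-vertex ρ j) (position-vertex ρ i))
                     (cong₂ _-_ (position-vertex σ j) (position-vertex σ i))
                     (agree sim (i ↑ˡ 2) (j ↑ˡ 2))

  same-vertex : ∀ {T r n m} (ρ : Fin r → Fin n) (σ : Fin r → Fin m) → 0ℤ < T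
              → Similar T (position n ρ) (position m σ) → ∀ {i j} → ρ i ≡ ρ j → σ i ≡ σ j
  same-vertex ρ σ 0<T sim {i} {j} ρi≡ρj = toℕ-injective (+-injective (begin
    + toℕ (σ i)               ≡⟨ sym (position-vertex σ i) ⟩
    position _ σ (i ↑ˡ 2)     ≡⟨ similar-≡ 0<T sim ρ-equal ⟩
    position _ σ (j ↑ˡ 2)     ≡⟨ position-vertex σ j ⟩
    + toℕ (σ j)               ∎))
    where
    open ≡-Reasoning
    ρ-equal : position _ ρ (i ↑ˡ 2) ≡ position _ ρ (j ↑ˡ 2)
    ρ-equal = trans (position-vertex ρ i)
                (trans (cong (+_ ∘ toℕ) ρi≡ρj) (sym (position-vertex ρ j)))

  isYes-⇔ : ∀ {A B : Set} → A ⇔ B → (a? : Dec A) (b? : Dec B) → ⌊ a? ⌋ ≡ ⌊ b? ⌋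
  isYes-⇔ A⇔B a? b? = trans (isYes≗does a?) (trans (does-⇔ A⇔B a? b?) (sym (isYes≗does b?)))

  module Game (E : ℤ → Bool) (B : ℕ)
              (E-short : ∀ u → + suc B ≤ u ⊎ u ≤ - + suc B → E u ≡ false) where

    edge-agree : ∀ {T u v} → + suc B ≤ T → Agree T u v → E u ≡ E v
    edge-agree _ same = refl
    edge-agree B<T (above T≤u T≤v) =
      trans (E-short _ (inj₁ (≤-trans B<T T≤u))) (sym (E-short _ (inj₁ (≤-trans B<T T≤v))))
    edge-agree B<T (below u≤-T v≤-T) =
      trans (E-short _ (inj₂ (≤-trans u≤-T (neg-mono-≤ B<T))))
            (sym (E-short _ (inj₂ (≤-trans v≤-T (neg-mono-≤ B<T)))))

    threshold : ℕ → ℕ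
    threshold zero = suc B
    threshold (suc d) = threshold d ℕ.+ threshold d

    B<threshold : ∀ d → suc B ℕ.≤ threshold d
    B<threshold zero = ℕ.≤-refl
    B<threshold (suc d) = ℕ.≤-trans (B<threshold d) (ℕ.m≤m+n (threshold d) (threshold d))

    0<threshold : ∀ d → 0ℤ < + threshold d
    0<threshold d = +<+ (ℕ.<-≤-trans (s≤s z≤n) (B<threshold d))

    Similarᵈ : ∀ d {r n m} → (Fin r → Fin n) → (Fin r → Fin m) → Set
    Similarᵈ d {n = n} {m} ρ σ = Similar (+ threshold d) (position n ρ) (position m σ)

    -- A response placed like a vertex x relative to a position, sentinels
    -- included, lies between the sentinels 0 and m, so it is a vertex of [m].
    response-vertex : ∀ {T r n m} (ρ : Fin r → Fin n) (σ : Fin r → Fin m) (x : Fin n) {y} → 0ℤ < T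
         → Similar T (+ toℕ x ∷ position n ρ) (y ∷ position m σ)
         → ∃ λ k → Similar T (position n (extend x ρ)) (position m (extend k σ))
    response-vertex {T} {r} {n} {m} ρ σ x {y} 0<T sim with vertex 0≤y y<m
      where
      0≤y : 0ℤ ≤ y
      0≤y = subst (_≤ y) (position-sentinel r σ Fin.zero)
              (similar-≤ 0<T sim {Fin.suc (r ↑ʳ Fin.zero)} {Fin.zero}
                (subst (_≤ + toℕ x) (sym (position-sentinel r ρ Fin.zero)) (+≤+ z≤n)))
      y<m : y < + m
      y<m = subst (y <_) (position-sentinel r σ (Fin.suc Fin.zero))
              (similar-< 0<T sim {Fin.zero} {Fin.suc (r ↑ʳ Fin.suc Fin.zero)}
                (subst (+ toℕ x <_) (sym (position-sentinel r ρ (Fin.suc Fin.zero))) (+<+ (toℕ<n x))))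
    ... | k , k≡y = k , subst (λ z → Similar T (+ toℕ x ∷ position n ρ) (z ∷ position m σ)) (sym k≡y) sim

    respond : ∀ {d r n m} (ρ : Fin r → Fin n) (σ : Fin r → Fin m) → Similarᵈ (suc d) ρ σ
            → (x : Fin n) → ∃ λ y → Similarᵈ d (extend x ρ) (extend y σ)
    respond {d} {r} {n} ρ σ sim x =
      let y , placed = extension (0<threshold d) sim (r ↑ʳ Fin.zero , low≤x)
      in response-vertex ρ σ x {y} (0<threshold d) (similar-cons (i≤i+j Tᵈ Tᵈ) sim placed)
      where
      Tᵈ : ℤ
      Tᵈ = + threshold d
      low≤x : position n ρ (r ↑ʳ Fin.zero) ≤ + toℕ x
      low≤x = subst (_≤ + toℕ x) (sym (position-sentinel r ρ Fin.zero)) (+≤+ z≤n)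

    matching : ∀ {d r n m} {G : Graph n} {H : Graph m} (φ : Formula (suc r)) → depth φ ℕ.≤ d
             → IsDistanceGraph E G → IsDistanceGraph E H
             → (ρ : Fin r → Fin n) (σ : Fin r → Fin m) → Similarᵈ (suc d) ρ σ
             → BackAndForth (λ x → sat G φ (extend x ρ)) (λ y → sat H φ (extend y σ))

    sat-similar : ∀ {d r n m} {G : Graph n} {H : Graph m} (φ : Formula r) → depth φ ℕ.≤ d
                → IsDistanceGraph E G → IsDistanceGraph E H
                → (ρ : Fin r → Fin n) (σ : Fin r → Fin m) → Similarᵈ d ρ σ
                → sat G φ ρ ≡ sat H φ σ

    sat-similar₂ : ∀ {d r n m} {G : Graph n} {H : Graph m} (φ ψ : Formula r)
                 → depth φ ⊔ depth ψ ℕ.≤ d → IsDistanceGraph E G → IsDistanceGraph E H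
                 → (ρ : Fin r → Fin n) (σ : Fin r → Fin m) → Similarᵈ d ρ σ
                 → sat G φ ρ ≡ sat H φ σ × sat G ψ ρ ≡ sat H ψ σ
    sat-similar₂ φ ψ le gG gH ρ σ sim =
      sat-similar φ (ℕ.m⊔n≤o⇒m≤o (depth φ) (depth ψ) le) gG gH ρ σ sim ,
      sat-similar ψ (ℕ.m⊔n≤o⇒n≤o (depth φ) (depth ψ) le) gG gH ρ σ sim

    sat-similar {d} (i ≐ j) _ _ _ ρ σ sim =
      isYes-⇔ (mk⇔ (same-vertex ρ σ (0<threshold d) sim)
                   (same-vertex σ ρ (0<threshold d) (similar-sym sim))) _ _
    sat-similar {d} {G = G} {H} (i ∼ j) _ gG gH ρ σ sim = begin
      G (ρ i) (ρ j)                    ≡⟨ gG (ρ i) (ρ j) ⟩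
      E (+ toℕ (ρ j) - + toℕ (ρ i))    ≡⟨ edge-agree (+≤+ (B<threshold d)) (vertex-gap ρ σ sim i j) ⟩
      E (+ toℕ (σ j) - + toℕ (σ i))    ≡⟨ sym (gH (σ i) (σ j)) ⟩
      H (σ i) (σ j)                    ∎
      where open ≡-Reasoning
    sat-similar ⊤f _ _ _ _ _ _ = refl
    sat-similar ⊥f _ _ _ _ _ _ = refl
    sat-similar (¬f φ) le gG gH ρ σ sim = cong not (sat-similar φ le gG gH ρ σ sim)
    sat-similar (φ ∧f ψ) le gG gH ρ σ sim =
      let eφ , eψ = sat-similar₂ φ ψ le gG gH ρ σ sim in cong₂ _∧_ eφ eψ
    sat-similar (φ ∨f ψ) le gG gH ρ σ sim =
      let eφ , eψ = sat-similar₂ φ ψ le gG gH ρ σ sim in cong₂ _∨_ eφ eψ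
    sat-similar (φ ⇒f ψ) le gG gH ρ σ sim =
      let eφ , eψ = sat-similar₂ φ ψ le gG gH ρ σ sim in cong₂ (λ a b → not a ∨ b) eφ eψ
    sat-similar (∃f φ) (s≤s le) gG gH ρ σ sim = any-cong (matching φ le gG gH ρ σ sim)
    sat-similar (∀f φ) (s≤s le) gG gH ρ σ sim = all-cong (matching φ le gG gH ρ σ sim)

    matching {d} φ le gG gH ρ σ sim =
      (λ x → let y , sim′ = respond {d} ρ σ sim x
             in y , sat-similar φ le gG gH (extend x ρ) (extend y σ) sim′) ,
      (λ y → let x , sim′ = respond {d} σ ρ (similar-sym sim) y
             in x , sym (sat-similar φ le gH gG (extend y σ) (extend x ρ) sim′))

    sentence-agree : ∀ ψ {n m} {G : Graph n} {H : Graph m}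
                   → IsDistanceGraph E G → IsDistanceGraph E H
                   → threshold (depth ψ) ℕ.≤ n → threshold (depth ψ) ℕ.≤ m → G ⊨ ψ ≡ H ⊨ ψ
    sentence-agree ψ gG gH n-large m-large =
      sat-similar ψ ℕ.≤-refl gG gH noVars noVars (initial-similar (+≤+ n-large) (+≤+ m-large))

-- With probabilities in {0,1}, M^n_p̄ is surely one particular distance graph.
module SureGraphs where

  open import Defs
  open DistanceGraphs using (IsDistanceGraph)
  open import Data.Nat as ℕ using (ℕ; zero; suc; _∸_; _<_; s≤s)
  import Data.Nat.Properties as ℕ
  open import Data.Integer as ℤ using (ℤ; +_; -[1+_]; -_; +≤+; -≤-)
  import Data.Integer.Properties as ℤ
  open import Data.Fin as Fin using (Fin; toℕ)
  open import Data.Fin.Properties using (toℕ-injective)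
  open import Data.Bool using (Bool; true; false; if_then_else_)
  open import Data.Bool.Properties using (T-≡; T-not-≡)
  open import Data.List using (List; []; _∷_; allFin)
  open import Data.List.Membership.Propositional using (_∈_; lose)
  open import Data.List.Membership.Propositional.Properties
    using (∈-concatMap⁺; ∈-concatMap⁻; ∈-allFin)
  open import Data.List.Relation.Unary.Any using (here; there; satisfied)
  open import Data.Rational using (ℚ; 0ℚ; 1ℚ; _+_; _*_; _-_; _≟_)
  open import Data.Rational.Properties using (*-identityˡ; *-zeroˡ; +-identityʳ; +-identityˡ)
  open import Data.Product using (_×_; _,_; proj₁; proj₂)
  open import Data.Sum using (_⊎_; inj₁; inj₂)
  open import Function using (Equivalence)
  open import Relation.Nullary using (¬_; yes; no; contradiction)
  open import Relation.Nullary.Decidable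
    using (⌊_⌋; isYes≗does; dec-false; toWitness; fromWitness; fromWitnessFalse)
  open import Relation.Binary.Definitions using (tri<; tri≈; tri>)
  open import Relation.Binary.PropositionalEquality
    using (_≡_; refl; sym; trans; cong; cong₂; module ≡-Reasoning)

  isOne : ℚ → Bool
  isOne q = ⌊ q ≟ 1ℚ ⌋

  sureOutcome : ∀ {n} → (Fin n × Fin n → ℚ) → List (Fin n × Fin n) → Fin n → Fin n → Bool
  sureOutcome w [] = λ _ _ → false
  sureOutcome w (e ∷ es) = update e (isOne (w e)) (sureOutcome w es)

  sure-choice : ∀ q a b → q ≡ 0ℚ ⊎ q ≡ 1ℚ → q * a + (1ℚ - q) * b ≡ (if isOne q then a else b)
  sure-choice _ a b (inj₁ refl) = trans (cong₂ _+_ (*-zeroˡ a) (*-identityˡ b)) (+-identityˡ b)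
  sure-choice _ a b (inj₂ refl) = trans (cong₂ _+_ (*-identityˡ a) (*-zeroˡ b)) (+-identityʳ a)

  expect-sure : ∀ {n} (w : Fin n × Fin n → ℚ) es → (∀ e → e ∈ es → w e ≡ 0ℚ ⊎ w e ≡ 1ℚ)
              → ∀ f → expect w es f ≡ f (sureOutcome w es)
  expect-sure w [] _ f = refl
  expect-sure w (e ∷ es) zero-one f = begin
    w e * on true + (1ℚ - w e) * on false
      ≡⟨ sure-choice (w e) (on true) (on false) (zero-one e (here refl)) ⟩
    (if isOne (w e) then on true else on false)
      ≡⟨ cong₂ (if isOne (w e) then_else_) (rest true) (rest false) ⟩
    (if isOne (w e) then f (set true) else f (set false))
      ≡⟨ lift (isOne (w e)) ⟩
    f (set (isOne (w e)))                                         ∎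
    where
    open ≡-Reasoning
    on : Bool → ℚ
    on b = expect w es (λ g → f (update e b g))
    set : Bool → Fin _ → Fin _ → Bool
    set b = update e b (sureOutcome w es)
    rest : ∀ b → on b ≡ f (set b)
    rest b = expect-sure w es (λ e′ e′∈es → zero-one e′ (there e′∈es)) (λ g → f (update e b g))
    lift : ∀ b → (if b then f (set true) else f (set false)) ≡ f (set b)
    lift true = refl
    lift false = refl

  <ᵇ-true : ∀ {m n} → m < n → (m <ᵇ n) ≡ true
  <ᵇ-true m<n = Equivalence.to T-≡ (fromWitness m<n)

  <ᵇ-false : ∀ {m n} → ¬ m < n → (m <ᵇ n) ≡ false
  <ᵇ-false m≮n = Equivalence.to T-not-≡ (fromWitnessFalse m≮n)

  <ᵇ-sound : ∀ {m n} → (m <ᵇ n) ≡ true → m < n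
  <ᵇ-sound m<ᵇn = toWitness (Equivalence.from T-≡ m<ᵇn)

  pairs-complete : ∀ {n} {x y : Fin n} → toℕ x < toℕ y → (x , y) ∈ pairs n
  pairs-complete {x = x} {y} x<y =
    ∈-concatMap⁺ _ (lose (∈-allFin x) (∈-concatMap⁺ _ (lose (∈-allFin y) listed)))
    where
    listed : (x , y) ∈ (if toℕ x <ᵇ toℕ y then (x , y) ∷ [] else [])
    listed rewrite <ᵇ-true x<y = here refl

  pairs-ordered : ∀ {n} {x y : Fin n} → (x , y) ∈ pairs n → toℕ x < toℕ y
  pairs-ordered {n} x,y∈ with satisfied (∈-concatMap⁻ _ {xs = allFin n} x,y∈)
  ... | i , ∈row with satisfied (∈-concatMap⁻ _ {xs = allFin n} ∈row)
  ... | j , ∈cell = from-cell _ refl ∈cell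
    where
    from-cell : ∀ {x y} b → (toℕ i <ᵇ toℕ j) ≡ b → (x , y) ∈ (if b then (i , j) ∷ [] else [])
              → toℕ x < toℕ y
    from-cell true i<ᵇj (here refl) = <ᵇ-sound i<ᵇj

  sureOutcome-∈ : ∀ {n} (w : Fin n × Fin n → ℚ) es {x y} → (x , y) ∈ es
                → sureOutcome w es x y ≡ isOne (w (x , y))
  sureOutcome-∈ w (e ∷ es) {x} {y} x,y∈ with x Fin.≟ proj₁ e | y Fin.≟ proj₂ e | x,y∈
  ... | yes refl | yes refl | _ = refl
  ... | no x≢ | _ | here refl = contradiction refl x≢
  ... | yes _ | no y≢ | here refl = contradiction refl y≢
  ... | no _ | _ | there x,y∈es = sureOutcome-∈ w es x,y∈es
  ... | yes _ | no _ | there x,y∈es = sureOutcome-∈ w es x,y∈es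

  toGraph-< : ∀ {n} (g : Fin n → Fin n → Bool) {x y} → toℕ x < toℕ y → toGraph g x y ≡ g x y
  toGraph-< g x<y rewrite <ᵇ-true x<y = refl

  toGraph-> : ∀ {n} (g : Fin n → Fin n → Bool) {x y} → toℕ y < toℕ x → toGraph g x y ≡ g y x
  toGraph-> g y<x rewrite <ᵇ-false (ℕ.<⇒≯ y<x) | <ᵇ-true y<x = refl

  toGraph-loop : ∀ {n} (g : Fin n → Fin n → Bool) x → toGraph g x x ≡ false
  toGraph-loop g x rewrite <ᵇ-false (ℕ.<-irrefl {toℕ x} refl) = refl

  edgeWeight : (ℕ → ℚ) → ∀ {n} → Fin n × Fin n → ℚ
  edgeWeight p (i , j) = p (toℕ j ∸ toℕ i)

  edgeOf : (ℕ → ℚ) → ℤ → Bool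
  edgeOf p (+ zero) = false
  edgeOf p (+ suc k) = isOne (p (suc k))
  edgeOf p -[1+ k ] = isOne (p (suc k))

  sureGraph : (ℕ → ℚ) → ∀ n → Graph n
  sureGraph p n = toGraph (sureOutcome (edgeWeight p) (pairs n))

  module _ (p : ℕ → ℚ) (zero-one : ∀ i → 1 ℕ.≤ i → p i ≡ 0ℚ ⊎ p i ≡ 1ℚ) where

    Pr-sure : ∀ n ψ → Pr p n ψ ≡ indicator (sureGraph p n ⊨ ψ)
    Pr-sure n ψ = expect-sure (edgeWeight p) (pairs n) weight-0-1 (λ g → indicator (toGraph g ⊨ ψ))
      where
      weight-0-1 : ∀ e → e ∈ pairs n → edgeWeight p e ≡ 0ℚ ⊎ edgeWeight p e ≡ 1ℚ
      weight-0-1 (i , j) i,j∈ = zero-one _ (ℕ.m<n⇒0<n∸m (pairs-ordered i,j∈))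

    sureGraph-distance : ∀ n → IsDistanceGraph (edgeOf p) (sureGraph p n)
    sureGraph-distance n x y with ℕ.<-cmp (toℕ x) (toℕ y)
    ... | tri< x<y _ _ = begin
      toGraph g x y                   ≡⟨ toGraph-< g x<y ⟩
      g x y                           ≡⟨ sureOutcome-∈ (edgeWeight p) (pairs n) (pairs-complete x<y) ⟩
      isOne (p (toℕ y ∸ toℕ x))       ≡⟨ edge-ahead (ℕ.m<n⇒0<n∸m x<y) ⟩
      edgeOf p (+ (toℕ y ∸ toℕ x))    ≡⟨ cong (edgeOf p) (sym gap-ahead) ⟩
      edgeOf p (+ toℕ y ℤ.- + toℕ x)  ∎
      where
      open ≡-Reasoning
      g : Fin n → Fin n → Bool
      g = sureOutcome (edgeWeight p) (pairs n)
      edge-ahead : ∀ {k} → 0 < k → isOne (p k) ≡ edgeOf p (+ k)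
      edge-ahead {suc k} _ = refl
      gap-ahead : + toℕ y ℤ.- + toℕ x ≡ + (toℕ y ∸ toℕ x)
      gap-ahead = trans (ℤ.[+m]-[+n]≡m⊖n (toℕ y) (toℕ x)) (ℤ.⊖-≥ (ℕ.<⇒≤ x<y))
    ... | tri> _ _ y<x = begin
      toGraph g x y                   ≡⟨ toGraph-> g y<x ⟩
      g y x                           ≡⟨ sureOutcome-∈ (edgeWeight p) (pairs n) (pairs-complete y<x) ⟩
      isOne (p (toℕ x ∸ toℕ y))       ≡⟨ edge-behind (ℕ.m<n⇒0<n∸m y<x) ⟩
      edgeOf p (- + (toℕ x ∸ toℕ y))  ≡⟨ cong (edgeOf p) (sym gap-behind) ⟩
      edgeOf p (+ toℕ y ℤ.- + toℕ x)  ∎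
      where
      open ≡-Reasoning
      g : Fin n → Fin n → Bool
      g = sureOutcome (edgeWeight p) (pairs n)
      edge-behind : ∀ {k} → 0 < k → isOne (p k) ≡ edgeOf p (- + k)
      edge-behind {suc k} _ = refl
      gap-behind : + toℕ y ℤ.- + toℕ x ≡ - + (toℕ x ∸ toℕ y)
      gap-behind = trans (ℤ.[+m]-[+n]≡m⊖n (toℕ y) (toℕ x)) (ℤ.⊖-< y<x)
    ... | tri≈ _ x≡y _ rewrite toℕ-injective x≡y | ℤ.+-inverseʳ (+ toℕ y) =
      toGraph-loop (sureOutcome (edgeWeight p) (pairs n)) y

  edgeOf-short : ∀ p {B} → (∀ l → 1 ℕ.≤ l → p l ≡ 1ℚ → l ℕ.≤ B)
               → ∀ u → + suc B ℤ.≤ u ⊎ u ℤ.≤ - + suc B → edgeOf p u ≡ false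
  edgeOf-short p {B} bounded = short
    where
    beyond : ∀ l → B < l → isOne (p l) ≡ false
    beyond l B<l = trans (isYes≗does (p l ≟ 1ℚ))
      (dec-false (p l ≟ 1ℚ) (λ pl≡1 → ℕ.<⇒≱ B<l (bounded l (ℕ.<-≤-trans (s≤s ℕ.z≤n) B<l) pl≡1)))
    short : ∀ u → + suc B ℤ.≤ u ⊎ u ℤ.≤ - + suc B → edgeOf p u ≡ false
    short (+ zero) (inj₁ (+≤+ ()))
    short (+ suc k) (inj₁ (+≤+ B<k)) = beyond (suc k) B<k
    short -[1+ k ] (inj₂ (-≤- B≤k)) = beyond (suc k) (s≤s B≤k)

module EventuallyConstant where

  open import Defs using (ConvergesTo; indicator)
  open import Data.Nat using (ℕ; _≤_)
  open import Data.Bool using (true; false)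
  open import Data.Rational using (ℚ; 0ℚ; 1ℚ; ∣_∣; _-_; _<_)
  open import Data.Rational.Properties using (+-inverseʳ)
  open import Data.Product using (_,_)
  open import Data.Sum using (_⊎_; inj₁; inj₂)
  open import Relation.Binary.PropositionalEquality using (_≡_; refl; sym; subst)

  eventually-constant⇒converges : ∀ (a : ℕ → ℚ) L N → (∀ n → N ≤ n → a n ≡ L) → ConvergesTo a L
  eventually-constant⇒converges a L N constant ε 0<ε = N , λ n N≤n →
    subst (λ z → ∣ z - L ∣ < ε) (sym (constant n N≤n))
          (subst (λ z → ∣ z ∣ < ε) (sym (+-inverseʳ L)) 0<ε)

  indicator-0-1 : ∀ b → indicator b ≡ 0ℚ ⊎ indicator b ≡ 1ℚ
  indicator-0-1 true = inj₂ refl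
  indicator-0-1 false = inj₁ refl

open import Defs
open import Data.Nat using (ℕ; _≤_)
open import Data.Rational using (ℚ; 0ℚ; 1ℚ)
open import Data.Sum using (_⊎_)
open import Relation.Binary.PropositionalEquality using (_≡_)
open import Data.Product using (∃)

open import Data.Nat.Properties using (≤-refl)
open import Data.Product using (_,_)
open import Relation.Binary.PropositionalEquality using (cong; trans)
open DistanceGraphs using (depth; module Game)
open SureGraphs using (sureGraph; Pr-sure; sureGraph-distance; edgeOf; edgeOf-short)
open EventuallyConstant

lemma4p5 : (p : ℕ → ℚ)
    → (∀ i → 1 ≤ i → p i ≡ 0ℚ ⊎ p i ≡ 1ℚ)
    → (∃ λ B → ∀ l → 1 ≤ l → p l ≡ 1ℚ → l ≤ B)
    → ZeroOneLaw p
lemma4p5 p zero-one (B , bounded) ψ =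
  limit , indicator-0-1 (sureGraph p N ⊨ ψ) , eventually-constant⇒converges (λ n → Pr p n ψ) limit N stable
  where
  open Game (edgeOf p) B (edgeOf-short p bounded)
  N : ℕ
  N = threshold (depth ψ)
  limit : ℚ
  limit = indicator (sureGraph p N ⊨ ψ)
  stable : ∀ n → N ≤ n → Pr p n ψ ≡ limit
  stable n N≤n = trans (Pr-sure p zero-one n ψ) (cong indicator
    (sentence-agree ψ (sureGraph-distance p zero-one n) (sureGraph-distance p zero-one N) N≤n ≤-refl))
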